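{- There are infinitely many positive integers $N$ that can be written as $N = A/B$ with $A, B$ antipalindromic numbers.
   Context: A positive integer is antipalindromic if its base-$2$ representation (without leading zeros) $w_1 \cdots w_{2m}$ has even length and satisfies $w_i + w_{2m+1-i} = 1$ for all $i$ (the second half is the reverse complement of the first half). -}

module Defs where

open import Data.Nat using (ℕ; zero; suc; _+_; _*_; _∸_; _^_; _≤_; _<_)
open import Data.Nat.DivMod using (_/_; _%_)
open import Data.Product using (Σ; _×_; ∃)
open import Relation.Binary.PropositionalEquality using (_≡_)

bit : ℕ → ℕ → ℕ
bit n zero = n % 2
bit n (suc i) = bit (n / 2) i

HasBinaryLength : ℕ → ℕ → Set
HasBinaryLength n L = (1 ≤ L) × (2 ^ (L ∸ 1) ≤ n) × (n < 2 ^ L)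

-- antipalindromic: binary length 2m (m ≥ 1) and w_i + w_{2m+1-i} = 1 for all i.
-- Indexing digits from the least significant end instead of the most
-- significant end gives the same condition (the pairing i ↔ 2m-1-i is symmetric).
Antipalindromic : ℕ → Set
Antipalindromic n = ∃ λ m → HasBinaryLength n (2 * m) ×
  (∀ i → i < 2 * m → bit n i + bit n (2 * m ∸ 1 ∸ i) ≡ 1)

-- The word 1ᵐ0ᵐ is antipalindromic, and so is 10 = 2. The value of 1ᵐ0ᵐ is
-- (2ᵐ − 1)·2ᵐ, so N = (2ᵐ − 1)·2ᵐ⁻¹ is a quotient of two antipalindromic
-- numbers for every m ≥ 1, and these N are unbounded.
module Submission where

open import Defs
open import Data.Nat using (ℕ; zero; suc; _+_; _*_; _∸_; _^_; _≤_; _<_; z≤n; s≤s; z<s; _<?_)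
open import Data.Nat.Properties
open import Data.Nat.DivMod using (_/_; _%_; m<n⇒m%n≡m; m<n⇒m/n≡0; m*n%n≡0; m*n/n≡m; [m+kn]%n≡m%n; +-distrib-/)
open import Data.Product using (_×_; ∃; _,_)
open import Relation.Binary.PropositionalEquality
open import Relation.Nullary using (yes; no)

bit-0-[b+y*2] : ∀ b y → b < 2 → bit (b + y * 2) 0 ≡ b
bit-0-[b+y*2] b y b<2 = trans ([m+kn]%n≡m%n b y 2) (m<n⇒m%n≡m b<2)

[b+y*2]/2≡y : ∀ b y → b < 2 → (b + y * 2) / 2 ≡ y
[b+y*2]/2≡y b y b<2 = begin
  (b + y * 2) / 2    ≡⟨ +-distrib-/ b (y * 2) no-carry ⟩
  b / 2 + y * 2 / 2  ≡⟨ cong₂ _+_ (m<n⇒m/n≡0 b<2) (m*n/n≡m y 2) ⟩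
  y                  ∎
  where
  open ≡-Reasoning
  no-carry : b % 2 + y * 2 % 2 < 2
  no-carry = subst (_< 2)
    (sym (trans (cong₂ _+_ (m<n⇒m%n≡m b<2) (m*n%n≡0 y 2)) (+-identityʳ b))) b<2

bit-suc-[b+y*2] : ∀ b y i → b < 2 → bit (b + y * 2) (suc i) ≡ bit y i
bit-suc-[b+y*2] b y i b<2 = cong (λ z → bit z i) ([b+y*2]/2≡y b y b<2)

x*2^suc : ∀ x m → x * 2 ^ suc m ≡ x * 2 ^ m * 2
x*2^suc x m = trans (cong (x *_) (*-comm 2 (2 ^ m))) (sym (*-assoc x (2 ^ m) 2))

bit-*2^-low : ∀ x {m j} → j < m → bit (x * 2 ^ m) j ≡ 0
bit-*2^-low x {suc m} {zero} _ =
  trans (cong (λ z → bit z 0) (x*2^suc x m)) (bit-0-[b+y*2] 0 (x * 2 ^ m) z<s)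
bit-*2^-low x {suc m} {suc j} (s≤s j<m) =
  trans (cong (λ z → bit z (suc j)) (x*2^suc x m))
        (trans (bit-suc-[b+y*2] 0 (x * 2 ^ m) j z<s) (bit-*2^-low x j<m))

bit-*2^-high : ∀ x m j → bit (x * 2 ^ m) (m + j) ≡ bit x j
bit-*2^-high x zero j = cong (λ z → bit z j) (*-identityʳ x)
bit-*2^-high x (suc m) j =
  trans (cong (λ z → bit z (suc (m + j))) (x*2^suc x m))
        (trans (bit-suc-[b+y*2] 0 (x * 2 ^ m) (m + j) z<s) (bit-*2^-high x m j))

hasBinaryLength-*2^ : ∀ {x L} m → HasBinaryLength x L → HasBinaryLength (x * 2 ^ m) (L + m)
hasBinaryLength-*2^ {x} {L} m (1≤L , lower , upper) =
  ≤-trans 1≤L (m≤m+n L m) , lower′ , upper′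
  where
  lower′ : 2 ^ (L + m ∸ 1) ≤ x * 2 ^ m
  lower′ rewrite +-∸-comm m 1≤L | ^-distribˡ-+-* 2 (L ∸ 1) m = *-monoˡ-≤ (2 ^ m) lower
  upper′ : x * 2 ^ m < 2 ^ (L + m)
  upper′ rewrite ^-distribˡ-+-* 2 L m = *-monoˡ-< (2 ^ m) {{m^n≢0 2 m}} upper

repunit : ℕ → ℕ
repunit zero = 0
repunit (suc m) = 1 + repunit m * 2

bit-repunit : ∀ {m j} → j < m → bit (repunit m) j ≡ 1
bit-repunit {suc m} {zero} _ = bit-0-[b+y*2] 1 (repunit m) ≤-refl
bit-repunit {suc m} {suc j} (s≤s j<m) =
  trans (bit-suc-[b+y*2] 1 (repunit m) j ≤-refl) (bit-repunit j<m)

suc-repunit : ∀ m → suc (repunit m) ≡ 2 ^ m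
suc-repunit zero = refl
suc-repunit (suc m) = begin
  suc (repunit m) * 2  ≡⟨ cong (_* 2) (suc-repunit m) ⟩
  2 ^ m * 2            ≡⟨ *-comm (2 ^ m) 2 ⟩
  2 ^ suc m            ∎
  where open ≡-Reasoning

n≤repunit : ∀ n → n ≤ repunit n
n≤repunit zero = z≤n
n≤repunit (suc n) = s≤s (≤-trans (n≤repunit n) (m≤m*n (repunit n) 2))

hasBinaryLength-repunit : ∀ m → HasBinaryLength (repunit (suc m)) (suc m)
hasBinaryLength-repunit m = s≤s z≤n , lower , upper
  where
  lower : 2 ^ m ≤ repunit (suc m)
  lower = subst (_≤ repunit (suc m)) (suc-repunit m) (s≤s (m≤m*n (repunit m) 2))
  upper : repunit (suc m) < 2 ^ suc m
  upper = subst (repunit (suc m) <_) (suc-repunit (suc m)) ≤-refl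

2*m∸m≡m : ∀ m → 2 * m ∸ m ≡ m
2*m∸m≡m m = trans (m+n∸m≡n m (m + 0)) (+-identityʳ m)

n∸1∸i≡n∸suc[i] : ∀ n i → n ∸ 1 ∸ i ≡ n ∸ suc i
n∸1∸i≡n∸suc[i] n i = ∸-+-assoc n 1 i

mirror-< : ∀ {n i} → i < n → n ∸ 1 ∸ i < n
mirror-< {n} {i} i<n = subst (_< n) (sym (n∸1∸i≡n∸suc[i] n i)) (∸-monoʳ-< z<s i<n)

mirror-low : ∀ {m i} → i < m → m ≤ 2 * m ∸ 1 ∸ i
mirror-low {m} {i} i<m =
  subst₂ _≤_ (2*m∸m≡m m) (sym (n∸1∸i≡n∸suc[i] (2 * m) i)) (∸-monoʳ-≤ (2 * m) i<m)

mirror-high : ∀ {m i} → m ≤ i → i < 2 * m → 2 * m ∸ 1 ∸ i < m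
mirror-high {m} {i} m≤i i<2m =
  subst₂ _<_ (sym (n∸1∸i≡n∸suc[i] (2 * m) i)) (2*m∸m≡m m) (∸-monoʳ-< (s≤s m≤i) i<2m)

onesZeros : ℕ → ℕ
onesZeros m = repunit m * 2 ^ m

bit-onesZeros-low : ∀ {m i} → i < m → bit (onesZeros m) i ≡ 0
bit-onesZeros-low {m} = bit-*2^-low (repunit m)

bit-onesZeros-high : ∀ {m i} → m ≤ i → i < 2 * m → bit (onesZeros m) i ≡ 1
bit-onesZeros-high {m} {i} m≤i i<2m = begin
  bit (onesZeros m) i              ≡⟨ cong (bit (onesZeros m)) (sym (m+[n∸m]≡n m≤i)) ⟩
  bit (onesZeros m) (m + (i ∸ m))  ≡⟨ bit-*2^-high (repunit m) m (i ∸ m) ⟩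
  bit (repunit m) (i ∸ m)          ≡⟨ bit-repunit i∸m<m ⟩
  1                                ∎
  where
  open ≡-Reasoning
  i∸m<m : i ∸ m < m
  i∸m<m = subst (i ∸ m <_) (2*m∸m≡m m) (∸-monoˡ-< i<2m m≤i)

bit-onesZeros-complement : ∀ m i → i < 2 * m →
  bit (onesZeros m) i + bit (onesZeros m) (2 * m ∸ 1 ∸ i) ≡ 1
bit-onesZeros-complement m i i<2m with i <? m
... | yes i<m
  rewrite bit-onesZeros-low i<m
        | bit-onesZeros-high (mirror-low i<m) (mirror-< i<2m) = refl
... | no i≮m
  rewrite bit-onesZeros-high (≮⇒≥ i≮m) i<2m
        | bit-onesZeros-low (mirror-high (≮⇒≥ i≮m) i<2m) = refl

antipalindromic-onesZeros : ∀ m → Antipalindromic (onesZeros (suc m))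
antipalindromic-onesZeros m = suc m , length , bit-onesZeros-complement (suc m)
  where
  length : HasBinaryLength (onesZeros (suc m)) (2 * suc m)
  length = subst (HasBinaryLength (onesZeros (suc m)))
                 (cong (suc m +_) (sym (+-identityʳ (suc m))))
                 (hasBinaryLength-*2^ (suc m) (hasBinaryLength-repunit m))

theorem16 : ∀ (k : ℕ) → ∃ λ N → (k < N) × (0 < N) ×
    (∃ λ A → ∃ λ B → Antipalindromic A × Antipalindromic B × A ≡ N * B)
theorem16 k =
  N , k<N , ≤-trans z<s k<N ,
  onesZeros (suc k) , onesZeros 1 ,
  antipalindromic-onesZeros k , antipalindromic-onesZeros 0 ,
  x*2^suc (repunit (suc k)) k
  where
  N : ℕ
  N = repunit (suc k) * 2 ^ k
  k<N : k < N
  k<N = ≤-trans (n≤repunit (suc k)) (m≤m*n (repunit (suc k)) (2 ^ k) {{m^n≢0 2 k}})
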